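{- Let $B=(G,\mathbf{i},V_+,V_0,V_-,\rho,X)$ be a symmetric labeled bigraph with dual $B^*=(G^*,\mathbf{i}^*,U_+,U_0,U_-,\rho^*,X^*)$, and let $v_i\in V_0$. Define $\lambda:V\to\mathbb{R}$ and $\lambda^*:U\to\mathbb{R}$ to agree with $\rho$, resp. $\rho^*$, at all vertices other than $v_i$, resp. other than $u_i^+,u_i^-$, and set $$\lambda(v_i)+\rho(v_i)=\max\Big(\sum_{\{w,v_i\}\in\Gamma}\rho(w),\sum_{\{v_i,w\}\in\Delta}\rho(w)\Big),\quad \lambda^*(u_i^\pm)+\rho^*(u_i^\pm)=\max\Big(\sum_{\{w,u_i^\pm\}\in\Gamma^*}\rho^*(w),\sum_{\{u_i^\pm,w\}\in\Delta^*}\rho^*(w)\Big).$$ Then $(G,\mathbf{i},V_+,V_0,V_-,\lambda,X)$ and $(G^*,\mathbf{i}^*,U_+,U_0,U_-,\lambda^*,X^*)$ are symmetric labeled bigraphs dual to each other.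
   Context: A bigraph $G=(\Gamma,\Delta)$ is a pair of simple graphs on a common vertex set $V$ sharing no edges; it is bipartite if some $\epsilon:V\to\{0,1\}$ properly 2-colors both. A symmetric labeled bigraph $B=(G,\mathbf{i},V_+,V_0,V_-,\rho,X)$ consists of: a bipartite bigraph $G$ on $V$; an automorphism $\mathbf{i}$ of $G$ of order 2 preserving $\epsilon$ and preserving $\Gamma$ and $\Delta$; $V_0$ the set of fixed points of $\mathbf{i}$; a partition $V=V_+\sqcup V_0\sqcup V_-$ such that for $u\ne v$ with $u=\mathbf{i}(v)$ one of $u,v$ lies in $V_+$ and the other in $V_-$; a labeling $\rho:V\to\mathbb{R}$ with $\rho(\mathbf{i}(v))=\rho(v)$; and a set $X$ of edges of $G$ both of whose endpoints lie in $V_0$. (Without $\rho$ it is a symmetric unlabeled bigraph.) Write $V_+=\{v_1^+,\dots,v_k^+\}$, $V_-=\{v_1^-,\dots,v_k^-\}$ with $\mathbf{i}(v_j^+)=v_j^-$, and $V_0=\{v_{k+1},\dots,v_n\}$. The dual $B^*=(G^*,\mathbf{i}^*,U_+,U_0,U_-,\rho^*,X^*)$: $U_0=\{u_1,\dots,u_k\}$, $U_\pm=\{u_{k+1}^\pm,\dots,u_n^\pm\}$, $U=U_+\sqcup U_0\sqcup U_-$; $\mathbf{i}^*$ fixes each $u_j$ and swaps $u_j^+\leftrightarrow u_j^-$; $\rho^*(u_j)=\sqrt2\,\rho(v_j^\pm)$ for $j\le k$, $\rho^*(u_j^\pm)=\rho(v_j)/\sqrt2$ for $j>k$; each vertex inherits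 the color $\epsilon$ of the corresponding vertex of $G$. $\Gamma^*$ and $X^*\cap\Gamma^*$ are given by: $\{v_i,v_j\}\in\Gamma\cap X$ iff $\{u_i^+,u_j^-\},\{u_i^-,u_j^+\}\in\Gamma^*$; $\{v_i,v_j\}\in\Gamma\setminus X$ iff $\{u_i^+,u_j^+\},\{u_i^-,u_j^-\}\in\Gamma^*$; $\{v_i^+,v_j\},\{v_i^-,v_j\}\in\Gamma$ iff $\{u_i^+,u_j\},\{u_i^-,u_j\}\in\Gamma^*$; $\{v_i^+,v_j^+\},\{v_i^-,v_j^-\}\in\Gamma$ iff $\{u_i,u_j\}\in\Gamma^*\setminus X^*$; $\{v_i^+,v_j^-\},\{v_i^-,v_j^+\}\in\Gamma$ iff $\{u_i,u_j\}\in\Gamma^*\cap X^*$. $\Delta^*$ and $X^*\cap\Delta^*$ are defined by the same rules with $\Delta$ in place of $\Gamma$. The dual of a symmetric unlabeled bigraph is defined the same way, omitting labels. -}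

module Defs where

open import Level using (0ℓ)
open import Data.Bool using (Bool; true; false; if_then_else_; not)
open import Data.Nat using (ℕ; zero; suc)
open import Data.Fin using (Fin)
open import Data.Product using (_×_; ∃; _,_)
open import Data.Sum using (_⊎_)
open import Relation.Nullary using (¬_)
open import Relation.Binary.Core using (Rel)
open import Relation.Binary.Structures using (IsTotalOrder)
open import Relation.Binary.PropositionalEquality using (_≡_)
open import Algebra.Core using (Op₁; Op₂)
open import Algebra.Structures using (IsCommutativeRing)
open import Function.Bundles using (_⇔_)

-- The real numbers, axiomatised as a complete ordered field.
-- (agda-stdlib has no reals; a complete ordered field is unique up to
-- isomorphism, so quantifying over all such fields is the same as
-- speaking about ℝ.)

record RealField : Set₁ where
  infixl 7 _*_
  infixl 6 _+_
  infix 4 _≈_ _≤_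
  field
    Carrier : Set
    _≈_ : Rel Carrier 0ℓ
    _+_ : Op₂ Carrier
    _*_ : Op₂ Carrier
    -_  : Op₁ Carrier
    0#  : Carrier
    1#  : Carrier
    isCommutativeRing : IsCommutativeRing _≈_ _+_ _*_ -_ 0# 1#
    0≉1 : ¬ (0# ≈ 1#)
    inverse : ∀ x → ¬ (x ≈ 0#) → ∃ λ y → x * y ≈ 1#
    _≤_ : Rel Carrier 0ℓ
    isTotalOrder : IsTotalOrder _≈_ _≤_
    +-monoˡ-≤ : ∀ {x y} z → x ≤ y → x + z ≤ y + z
    *-nonneg  : ∀ {x y} → 0# ≤ x → 0# ≤ y → 0# ≤ x * y
    complete : (P : Carrier → Set) → ∃ P → (∃ λ b → ∀ x → P x → x ≤ b) →
               ∃ λ s → (∀ x → P x → x ≤ s) × (∀ b → (∀ x → P x → x ≤ b) → s ≤ b)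

  infix 4 _<_
  _<_ : Rel Carrier 0ℓ
  x < y = (x ≤ y) × ¬ (x ≈ y)

  2# : Carrier
  2# = 1# + 1#

  IsMax : Carrier → Carrier → Carrier → Set
  IsMax a b c = (a ≤ c) × (b ≤ c) × ((c ≈ a) ⊎ (c ≈ b))

-- Vertices of a symmetric bigraph with |V₊| = |V₋| = k, |V₀| = m.
-- v₊ j and v₋ j are v_j^+ and v_j^- ; v₀ j is a fixed vertex.

data Vtx (k m : ℕ) : Set where
  v₊ : Fin k → Vtx k m
  v₀ : Fin m → Vtx k m
  v₋ : Fin k → Vtx k m

inv : ∀ {k m} → Vtx k m → Vtx k m
inv (v₊ j) = v₋ j
inv (v₀ j) = v₀ j
inv (v₋ j) = v₊ j

record SUB (k m : ℕ) : Set where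
  field
    Γ Δ : Vtx k m → Vtx k m → Bool
    Γ-sym : ∀ u v → Γ u v ≡ Γ v u
    Δ-sym : ∀ u v → Δ u v ≡ Δ v u
    Γ-irr : ∀ v → Γ v v ≡ false
    Δ-irr : ∀ v → Δ v v ≡ false
    disjoint : ∀ u v → Γ u v ≡ true → Δ u v ≡ false
    ε : Vtx k m → Bool
    Γ-col : ∀ u v → Γ u v ≡ true → ε u ≡ not (ε v)
    Δ-col : ∀ u v → Δ u v ≡ true → ε u ≡ not (ε v)
    inv-Γ : ∀ u v → Γ (inv u) (inv v) ≡ Γ u v
    inv-Δ : ∀ u v → Δ (inv u) (inv v) ≡ Δ u v
    inv-ε : ∀ v → ε (inv v) ≡ ε v
    X : Fin m → Fin m → Bool
    X-sym : ∀ a b → X a b ≡ X b a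
    X-edge : ∀ a b → X a b ≡ true → (Γ (v₀ a) (v₀ b) ≡ true) ⊎ (Δ (v₀ a) (v₀ b) ≡ true)

DualEdges : ∀ {k m} → (Vtx k m → Vtx k m → Bool) → (Fin m → Fin m → Bool) →
            (Vtx m k → Vtx m k → Bool) → (Fin k → Fin k → Bool) → Set
DualEdges {k} {m} E X E* X* =
  (∀ (a b : Fin m) →
     ((E (v₀ a) (v₀ b) ≡ true) × (X a b ≡ true)) ⇔
     ((E* (v₊ a) (v₋ b) ≡ true) × (E* (v₋ a) (v₊ b) ≡ true))) ×
  (∀ (a b : Fin m) →
     ((E (v₀ a) (v₀ b) ≡ true) × (X a b ≡ false)) ⇔
     ((E* (v₊ a) (v₊ b) ≡ true) × (E* (v₋ a) (v₋ b) ≡ true))) ×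
  (∀ (a : Fin k) (j : Fin m) →
     ((E (v₊ a) (v₀ j) ≡ true) × (E (v₋ a) (v₀ j) ≡ true)) ⇔
     ((E* (v₊ j) (v₀ a) ≡ true) × (E* (v₋ j) (v₀ a) ≡ true))) ×
  (∀ (a b : Fin k) →
     ((E (v₊ a) (v₊ b) ≡ true) × (E (v₋ a) (v₋ b) ≡ true)) ⇔
     ((E* (v₀ a) (v₀ b) ≡ true) × (X* a b ≡ false))) ×
  (∀ (a b : Fin k) →
     ((E (v₊ a) (v₋ b) ≡ true) × (E (v₋ a) (v₊ b) ≡ true)) ⇔
     ((E* (v₀ a) (v₀ b) ≡ true) × (X* a b ≡ true)))

IsDualU : ∀ {k m} → SUB k m → SUB m k → Set
IsDualU {k} {m} B B* =
  (∀ (a : Fin k) → SUB.ε B* (v₀ a) ≡ SUB.ε B (v₊ a)) ×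
  (∀ (j : Fin m) → SUB.ε B* (v₊ j) ≡ SUB.ε B (v₀ j)) ×
  (∀ (j : Fin m) → SUB.ε B* (v₋ j) ≡ SUB.ε B (v₀ j)) ×
  DualEdges (SUB.Γ B) (SUB.X B) (SUB.Γ B*) (SUB.X B*) ×
  DualEdges (SUB.Δ B) (SUB.X B) (SUB.Δ B*) (SUB.X B*)

module WithReals (R : RealField) where
  open RealField R

  IsSymLabel : ∀ {k m} → (Vtx k m → Carrier) → Set
  IsSymLabel {k} {m} ρ = ∀ (j : Fin k) → ρ (v₊ j) ≈ ρ (v₋ j)

  ΣFin : ∀ n → (Fin n → Carrier) → Carrier
  ΣFin zero f = 0#
  ΣFin (suc n) f = f Fin.zero + ΣFin n (λ i → f (Fin.suc i))

  ΣV : ∀ {k m} → (Vtx k m → Carrier) → Carrier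
  ΣV {k} {m} f = ΣFin k (λ j → f (v₊ j)) + ΣFin m (λ j → f (v₀ j)) + ΣFin k (λ j → f (v₋ j))

  nbrSum : ∀ {k m} → (Vtx k m → Vtx k m → Bool) → (Vtx k m → Carrier) → Vtx k m → Carrier
  nbrSum E ρ v = ΣV (λ w → if E w v then ρ w else 0#)

  -- dual labels, with s = √2:  ρ*(u_j) = √2 ρ(v_j^±),  √2 ρ*(u_j^±) = ρ(v_j)
  DualLabels : ∀ {k m} → Carrier → (Vtx k m → Carrier) → (Vtx m k → Carrier) → Set
  DualLabels {k} {m} s ρ ρ* =
    (∀ (a : Fin k) → ρ* (v₀ a) ≈ s * ρ (v₊ a)) ×
    (∀ (a : Fin k) → ρ* (v₀ a) ≈ s * ρ (v₋ a)) ×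
    (∀ (j : Fin m) → s * ρ* (v₊ j) ≈ ρ (v₀ j)) ×
    (∀ (j : Fin m) → s * ρ* (v₋ j) ≈ ρ (v₀ j))

  IsDual : ∀ {k m} → Carrier → SUB k m → (Vtx k m → Carrier) →
           SUB m k → (Vtx m k → Carrier) → Set
  IsDual s B ρ B* ρ* = IsDualU B B* × DualLabels s ρ ρ*

module Submission where

-- Labels away from v_i and u_i^± are unchanged, so all that must be shown is
-- λ*(u_i^-) = λ*(u_i^+) and s·λ*(u_i^+) = λ(v_i), with s = √2.  Each new
-- label is "max of the two neighbour sums, minus the old label", and maxima
-- are unique and commute with scaling by s ≥ 0.  Hence it suffices that the
-- neighbour sums at u_i^- and u_i^+ agree (by the symmetry 𝐢*, `nbrSum-inv`)
-- and that scaling by s turns each neighbour sum at u_i^+ in B* into the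
-- corresponding one at v_i in B (`scaled-nbrSum`).  The latter is a termwise
-- comparison: u_a contributes s·ρ*(u_a) = ρ(v_a^+) + ρ(v_a^-), and exactly
-- one of u_j^± is a neighbour of u_i^+ iff v_j is a neighbour of v_i.

open import Defs
open import Data.Nat using (ℕ)
open import Data.Fin using (Fin)
open import Data.Product using (_×_)
open import Relation.Binary.PropositionalEquality using (_≢_)

open import Data.Bool using (Bool; true; false; if_then_else_)
open import Data.Fin using (zero; suc) renaming (_≟_ to _≟ᶠ_)
open import Data.Product using (_,_; proj₁; proj₂)
open import Data.Sum as Sum using (inj₁; inj₂)
open import Relation.Nullary using (yes; no)
open import Relation.Binary.PropositionalEquality as ≡ using (_≡_)
open import Function.Bundles using (Equivalence; mk⇔; _⇔_)
open import Data.Bool.Properties using (⇔→≡)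
open import Algebra.Bundles using (CommutativeRing)
open import Relation.Binary.Structures using (IsTotalOrder)
import Algebra.Properties.Group as GroupProperties
import Algebra.Properties.CommutativeSemigroup as CommutativeSemigroupProperties
import Algebra.Properties.Semiring.Sum as SemiringSum
import Relation.Binary.Reasoning.Setoid as SetoidReasoning

module Lemmas (R : RealField) where
  open RealField R
  open WithReals R

  ring : CommutativeRing _ _
  ring = record { isCommutativeRing = isCommutativeRing }

  open CommutativeRing ring
    using (setoid; +-cong; *-cong; +-identityˡ; +-identityʳ; *-identityˡ; distribˡ; distribʳ;
           zeroʳ; *-assoc; -‿inverseʳ; +-group; +-commutativeSemigroup; semiring)
    renaming (refl to ≈-refl; sym to ≈-sym; trans to ≈-trans)
  open GroupProperties +-group using (//-rightDividesˡ) renaming (∙-cancelʳ to +-cancelʳ)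
  open CommutativeSemigroupProperties +-commutativeSemigroup
    using (xy∙z≈y∙xz; xy∙z≈zy∙x; xy∙z≈xz∙y)
  open SemiringSum semiring using (sum; sum-cong-≋; ∑-distrib-+; *-distribˡ-sum)
  open SetoidReasoning setoid
  module ≤ = IsTotalOrder isTotalOrder

  *-monoˡ-≤ : ∀ {s a c} → 0# ≤ s → a ≤ c → s * a ≤ s * c
  *-monoˡ-≤ {s} {a} {c} 0≤s a≤c = ≤.trans (≤.reflexive (≈-sym (+-identityˡ (s * a))))
    (≤.trans (+-monoˡ-≤ (s * a) (*-nonneg 0≤s 0≤c-a)) (≤.reflexive s[c-a]+sa≈sc))
    where
    0≤c-a : 0# ≤ c + - a
    0≤c-a = ≤.trans (≤.reflexive (≈-sym (-‿inverseʳ a))) (+-monoˡ-≤ (- a) a≤c)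
    s[c-a]+sa≈sc : s * (c + - a) + s * a ≈ s * c
    s[c-a]+sa≈sc = ≈-trans (≈-sym (distribˡ s (c + - a) a)) (*-cong ≈-refl (//-rightDividesˡ a c))

  IsMax-≤ : ∀ {a b c a′ b′ c′} → IsMax a b c → IsMax a′ b′ c′ → a ≈ a′ → b ≈ b′ → c ≤ c′
  IsMax-≤ (_ , _ , inj₁ c≈a) (a′≤c′ , _ , _) a≈a′ _ = ≤.trans (≤.reflexive (≈-trans c≈a a≈a′)) a′≤c′
  IsMax-≤ (_ , _ , inj₂ c≈b) (_ , b′≤c′ , _) _ b≈b′ = ≤.trans (≤.reflexive (≈-trans c≈b b≈b′)) b′≤c′

  IsMax-unique : ∀ {a b c a′ b′ c′} → IsMax a b c → IsMax a′ b′ c′ → a ≈ a′ → b ≈ b′ → c ≈ c′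
  IsMax-unique m m′ a≈a′ b≈b′ = ≤.antisym (IsMax-≤ m m′ a≈a′ b≈b′) (IsMax-≤ m′ m (≈-sym a≈a′) (≈-sym b≈b′))

  IsMax-scale : ∀ {s a b c} → 0# ≤ s → IsMax a b c → IsMax (s * a) (s * b) (s * c)
  IsMax-scale 0≤s (a≤c , b≤c , c≈a∨b) =
    *-monoˡ-≤ 0≤s a≤c , *-monoˡ-≤ 0≤s b≤c , Sum.map (*-cong ≈-refl) (*-cong ≈-refl) c≈a∨b

  -- `ΣFin` is the library's vector sum, so its algebra can be imported
  ΣFin≡sum : ∀ n (f : Fin n → Carrier) → ΣFin n f ≡ sum f
  ΣFin≡sum ℕ.zero f = ≡.refl
  ΣFin≡sum (ℕ.suc n) f = ≡.cong (f zero +_) (ΣFin≡sum n (λ i → f (suc i)))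

  ΣFin-cong : ∀ n {f g : Fin n → Carrier} → (∀ i → f i ≈ g i) → ΣFin n f ≈ ΣFin n g
  ΣFin-cong n {f} {g} f≈g = begin
    ΣFin n f ≡⟨ ΣFin≡sum n f ⟩
    sum f    ≈⟨ sum-cong-≋ f≈g ⟩
    sum g    ≡⟨ ΣFin≡sum n g ⟨
    ΣFin n g ∎

  ΣFin-+ : ∀ n (f g : Fin n → Carrier) → ΣFin n (λ i → f i + g i) ≈ ΣFin n f + ΣFin n g
  ΣFin-+ n f g = begin
    ΣFin n (λ i → f i + g i) ≡⟨ ΣFin≡sum n _ ⟩
    sum (λ i → f i + g i)    ≈⟨ ∑-distrib-+ f g ⟩
    sum f + sum g            ≡⟨ ≡.cong₂ _+_ (ΣFin≡sum n f) (ΣFin≡sum n g) ⟨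
    ΣFin n f + ΣFin n g      ∎

  ΣFin-* : ∀ n s (f : Fin n → Carrier) → s * ΣFin n f ≈ ΣFin n (λ i → s * f i)
  ΣFin-* n s f = begin
    s * ΣFin n f           ≡⟨ ≡.cong (s *_) (ΣFin≡sum n f) ⟩
    s * sum f              ≈⟨ *-distribˡ-sum s f ⟩
    sum (λ i → s * f i)    ≡⟨ ΣFin≡sum n _ ⟨
    ΣFin n (λ i → s * f i) ∎

  ΣV-cong : ∀ {k m} {f g : Vtx k m → Carrier} → (∀ v → f v ≈ g v) → ΣV f ≈ ΣV g
  ΣV-cong {k} {m} f≈g = +-cong (+-cong (ΣFin-cong k (λ j → f≈g (v₊ j))) (ΣFin-cong m (λ j → f≈g (v₀ j))))
                               (ΣFin-cong k (λ j → f≈g (v₋ j)))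

  ΣV-inv : ∀ {k m} (f : Vtx k m → Carrier) → ΣV f ≈ ΣV (λ w → f (inv w))
  ΣV-inv f = xy∙z≈zy∙x _ _ _

  gate : Bool → Carrier → Carrier
  gate b x = if b then x else 0#

  gate-cong : ∀ b {x y} → x ≈ y → gate b x ≈ gate b y
  gate-cong true x≈y = x≈y
  gate-cong false _ = ≈-refl

  gate-* : ∀ b s x → s * gate b x ≈ gate b (s * x)
  gate-* true s x = ≈-refl
  gate-* false s x = zeroʳ s

  gate-+ : ∀ b x y → gate b x + gate b y ≈ gate b (x + y)
  gate-+ true x y = ≈-refl
  gate-+ false x y = +-identityˡ 0#

  data Exclusive : Bool → Bool → Bool → Set where
    left  : Exclusive true false true
    right : Exclusive false true true
    none  : Exclusive false false false

  gate-exclusive : ∀ {p q e} → Exclusive p q e → ∀ x → gate p x + gate q x ≈ gate e x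
  gate-exclusive left x = +-identityʳ x
  gate-exclusive right x = +-identityˡ x
  gate-exclusive none x = +-identityˡ 0#

  label-inv : ∀ {k m} {ρ : Vtx k m → Carrier} → IsSymLabel ρ → ∀ w → ρ (inv w) ≈ ρ w
  label-inv symρ (v₊ j) = ≈-sym (symρ j)
  label-inv symρ (v₀ j) = ≈-refl
  label-inv symρ (v₋ j) = symρ j

  nbrSum-inv : ∀ {k m} (E : Vtx k m → Vtx k m → Bool) (ρ : Vtx k m → Carrier) →
               (∀ u v → E (inv u) (inv v) ≡ E u v) → IsSymLabel ρ →
               ∀ v → nbrSum E ρ (inv v) ≈ nbrSum E ρ v
  nbrSum-inv E ρ invE symρ v = ≈-trans (ΣV-inv (λ w → gate (E w (inv v)) (ρ w))) (ΣV-cong term)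
    where
    term : ∀ w → gate (E (inv w) (inv v)) (ρ (inv w)) ≈ gate (E w v) (ρ w)
    term w rewrite invE w v = gate-cong (E w v) (label-inv {ρ = ρ} symρ w)

  dual-label-centre : ∀ {k m} {s} {ρ : Vtx k m → Carrier} {ρ* : Vtx m k → Carrier} →
                      s * s ≈ 2# → IsSymLabel ρ → DualLabels s ρ ρ* →
                      ∀ a → s * ρ* (v₀ a) ≈ ρ (v₊ a) + ρ (v₋ a)
  dual-label-centre {s = s} {ρ} {ρ*} s²≈2 symρ (ρ*≈sρ₊ , _) a = begin
    s * ρ* (v₀ a)        ≈⟨ *-cong ≈-refl (ρ*≈sρ₊ a) ⟩
    s * (s * ρ (v₊ a))   ≈⟨ *-assoc s s (ρ (v₊ a)) ⟨
    (s * s) * ρ (v₊ a)   ≈⟨ *-cong s²≈2 ≈-refl ⟩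
    (1# + 1#) * ρ (v₊ a) ≈⟨ distribʳ (ρ (v₊ a)) 1# 1# ⟩
    1# * ρ (v₊ a) + 1# * ρ (v₊ a) ≈⟨ +-cong (*-identityˡ _) (*-identityˡ _) ⟩
    ρ (v₊ a) + ρ (v₊ a)  ≈⟨ +-cong ≈-refl (symρ a) ⟩
    ρ (v₊ a) + ρ (v₋ a)  ∎

  module DualNeighbours {k m : ℕ}
    (E : Vtx k m → Vtx k m → Bool) (X : Fin m → Fin m → Bool)
    (E* : Vtx m k → Vtx m k → Bool) (X* : Fin k → Fin k → Bool)
    (invE : ∀ u v → E (inv u) (inv v) ≡ E u v)
    (invE* : ∀ u v → E* (inv u) (inv v) ≡ E* u v)
    (symE* : ∀ u v → E* u v ≡ E* v u)
    (dual : DualEdges E X E* X*) (i : Fin m) where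

    open Equivalence using (to; from)
    rule-X : ∀ a b → ((E (v₀ a) (v₀ b) ≡ true) × (X a b ≡ true)) ⇔
                     ((E* (v₊ a) (v₋ b) ≡ true) × (E* (v₋ a) (v₊ b) ≡ true))
    rule-X = proj₁ dual
    rule-notX : ∀ a b → ((E (v₀ a) (v₀ b) ≡ true) × (X a b ≡ false)) ⇔
                        ((E* (v₊ a) (v₊ b) ≡ true) × (E* (v₋ a) (v₋ b) ≡ true))
    rule-notX = proj₁ (proj₂ dual)
    rule-pair : ∀ a j → ((E (v₊ a) (v₀ j) ≡ true) × (E (v₋ a) (v₀ j) ≡ true)) ⇔
                        ((E* (v₊ j) (v₀ a) ≡ true) × (E* (v₋ j) (v₀ a) ≡ true))
    rule-pair = proj₁ (proj₂ (proj₂ dual))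

    adjacent-centre : ∀ a → E* (v₀ a) (v₊ i) ≡ E (v₊ a) (v₀ i)
    adjacent-centre a = ⇔→≡ {z = true} (mk⇔ from-B* to-B*)
      where
      from-B* : E* (v₀ a) (v₊ i) ≡ true → E (v₊ a) (v₀ i) ≡ true
      from-B* u~u⁺ = proj₁ (from (rule-pair a i) (u⁺~u , ≡.trans (invE* (v₊ i) (v₀ a)) u⁺~u))
        where
        u⁺~u : E* (v₊ i) (v₀ a) ≡ true
        u⁺~u = ≡.trans (symE* (v₊ i) (v₀ a)) u~u⁺
      to-B* : E (v₊ a) (v₀ i) ≡ true → E* (v₀ a) (v₊ i) ≡ true
      to-B* v⁺~v = ≡.trans (symE* (v₀ a) (v₊ i))
                     (proj₁ (to (rule-pair a i) (v⁺~v , ≡.trans (invE (v₊ a) (v₀ i)) v⁺~v)))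

    via₊ : ∀ {j} → E* (v₊ j) (v₊ i) ≡ true → (E (v₀ j) (v₀ i) ≡ true) × (X j i ≡ false)
    via₊ {j} p = from (rule-notX j i) (p , ≡.trans (invE* (v₊ j) (v₊ i)) p)

    via₋ : ∀ {j} → E* (v₋ j) (v₊ i) ≡ true → (E (v₀ j) (v₀ i) ≡ true) × (X j i ≡ true)
    via₋ {j} q = from (rule-X j i) (≡.trans (invE* (v₋ j) (v₊ i)) q , q)

    -- v_j ~ v_i in B  iff  exactly one of u_j^+, u_j^- is adjacent to u_i^+
    -- (which one is decided by whether {v_j, v_i} ∈ X)
    pair-adjacency : ∀ j → Exclusive (E* (v₊ j) (v₊ i)) (E* (v₋ j) (v₊ i)) (E (v₀ j) (v₀ i))
    pair-adjacency j with E* (v₊ j) (v₊ i) in p | E* (v₋ j) (v₊ i) in q | E (v₀ j) (v₀ i) in e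
    ... | true  | false | true  = left
    ... | false | true  | true  = right
    ... | false | false | false = none
    ... | true  | true  | _     with () ← ≡.trans (≡.sym (proj₂ (via₊ p))) (proj₂ (via₋ q))
    ... | true  | false | false with () ← ≡.trans (≡.sym e) (proj₁ (via₊ p))
    ... | false | true  | false with () ← ≡.trans (≡.sym e) (proj₁ (via₋ q))
    ... | false | false | true  with X j i in x
    ...   | true  with () ← ≡.trans (≡.sym q) (proj₂ (to (rule-X j i) (e , x)))
    ...   | false with () ← ≡.trans (≡.sym p) (proj₁ (to (rule-notX j i) (e , x)))

    -- scaling by s turns the E*-neighbour sum at u_i^+ into the E-neighbour
    -- sum at v_i: the summand of u_a becomes those of v_a^±, and the summands
    -- of u_j^± together become that of v_j
    scaled-nbrSum : ∀ {s} {ρ : Vtx k m → Carrier} {ρ* : Vtx m k → Carrier} →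
                    s * s ≈ 2# → IsSymLabel ρ → DualLabels s ρ ρ* →
                    s * nbrSum E* ρ* (v₊ i) ≈ nbrSum E ρ (v₀ i)
    scaled-nbrSum {s} {ρ} {ρ*} s²≈2 symρ dualL@(_ , _ , sρ*₊≈ρ , sρ*₋≈ρ) = begin
      s * ((P* + Z*) + M*)   ≈⟨ *-cong ≈-refl (xy∙z≈y∙xz P* Z* M*) ⟩
      s * (Z* + (P* + M*))   ≈⟨ distribˡ s Z* (P* + M*) ⟩
      s * Z* + s * (P* + M*) ≈⟨ +-cong (ΣFin-* k s centre*)
                                        (≈-trans (*-cong ≈-refl (≈-sym (ΣFin-+ m pair₊ pair₋)))
                                                 (ΣFin-* m s (λ j → pair₊ j + pair₋ j))) ⟩
      ΣFin k (λ a → s * centre* a) + ΣFin m (λ j → s * (pair₊ j + pair₋ j))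
                             ≈⟨ +-cong (ΣFin-cong k centre-term) (ΣFin-cong m pair-term) ⟩
      ΣFin k (λ a → plus a + minus a) + Z
                             ≈⟨ +-cong (ΣFin-+ k plus minus) ≈-refl ⟩
      (P + M) + Z            ≈⟨ xy∙z≈xz∙y P M Z ⟩
      (P + Z) + M            ∎
      where
      pair₊ pair₋ : Fin m → Carrier
      pair₊ j = gate (E* (v₊ j) (v₊ i)) (ρ* (v₊ j))
      pair₋ j = gate (E* (v₋ j) (v₊ i)) (ρ* (v₋ j))
      centre* : Fin k → Carrier
      centre* a = gate (E* (v₀ a) (v₊ i)) (ρ* (v₀ a))
      plus minus : Fin k → Carrier
      plus a = gate (E (v₊ a) (v₀ i)) (ρ (v₊ a))
      minus a = gate (E (v₋ a) (v₀ i)) (ρ (v₋ a))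
      centre : Fin m → Carrier
      centre j = gate (E (v₀ j) (v₀ i)) (ρ (v₀ j))
      P* M* Z* P M Z : Carrier
      P* = ΣFin m pair₊
      M* = ΣFin m pair₋
      Z* = ΣFin k centre*
      P = ΣFin k plus
      M = ΣFin k minus
      Z = ΣFin m centre

      centre-term : ∀ a → s * centre* a ≈ plus a + minus a
      centre-term a = begin
        s * centre* a                         ≡⟨ ≡.cong (λ b → s * gate b (ρ* (v₀ a))) (adjacent-centre a) ⟩
        s * gate e (ρ* (v₀ a))                ≈⟨ gate-* e s (ρ* (v₀ a)) ⟩
        gate e (s * ρ* (v₀ a))                ≈⟨ gate-cong e (dual-label-centre {ρ = ρ} {ρ*} s²≈2 symρ dualL a) ⟩
        gate e (ρ (v₊ a) + ρ (v₋ a))          ≈⟨ gate-+ e (ρ (v₊ a)) (ρ (v₋ a)) ⟨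
        gate e (ρ (v₊ a)) + gate e (ρ (v₋ a)) ≡⟨ ≡.cong (λ b → plus a + gate b (ρ (v₋ a))) (invE (v₊ a) (v₀ i)) ⟨
        plus a + minus a                      ∎
        where
        e : Bool
        e = E (v₊ a) (v₀ i)

      pair-term : ∀ j → s * (pair₊ j + pair₋ j) ≈ centre j
      pair-term j = begin
        s * (pair₊ j + pair₋ j)                   ≈⟨ distribˡ s (pair₊ j) (pair₋ j) ⟩
        s * pair₊ j + s * pair₋ j                 ≈⟨ +-cong (gate-* p s (ρ* (v₊ j))) (gate-* q s (ρ* (v₋ j))) ⟩
        gate p (s * ρ* (v₊ j)) + gate q (s * ρ* (v₋ j))
                                                  ≈⟨ +-cong (gate-cong p (sρ*₊≈ρ j)) (gate-cong q (sρ*₋≈ρ j)) ⟩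
        gate p (ρ (v₀ j)) + gate q (ρ (v₀ j))     ≈⟨ gate-exclusive (pair-adjacency j) (ρ (v₀ j)) ⟩
        centre j                                  ∎
        where
        p q : Bool
        p = E* (v₊ j) (v₊ i)
        q = E* (v₋ j) (v₊ i)

  relabel-dual : ∀ {k m} {s} {ρ lam : Vtx k m → Carrier} {ρ* lam* : Vtx m k → Carrier} (i : Fin m) →
                 IsSymLabel ρ → IsSymLabel ρ* → DualLabels s ρ ρ* →
                 (∀ v → v ≢ v₀ i → lam v ≈ ρ v) → (∀ u → u ≢ v₊ i → u ≢ v₋ i → lam* u ≈ ρ* u) →
                 lam* (v₋ i) ≈ lam* (v₊ i) → s * lam* (v₊ i) ≈ lam (v₀ i) →
                 IsSymLabel lam × IsSymLabel lam* × DualLabels s lam lam*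
  relabel-dual {s = s} {ρ} {lam} {ρ*} {lam*} i symρ symρ* (ρ*≈sρ₊ , ρ*≈sρ₋ , sρ*₊≈ρ , sρ*₋≈ρ)
               same same* λ*₋≈λ*₊ sλ*₊≈λ =
    symλ , symλ* , dual-centre₊ , dual-centre₋ , dual-pair₊ , dual-pair₋
    where
    same₀ : ∀ {j} → j ≢ i → lam (v₀ j) ≈ ρ (v₀ j)
    same₀ j≢i = same (v₀ _) (λ { ≡.refl → j≢i ≡.refl })
    same*₊ : ∀ {j} → j ≢ i → lam* (v₊ j) ≈ ρ* (v₊ j)
    same*₊ j≢i = same* (v₊ _) (λ { ≡.refl → j≢i ≡.refl }) (λ ())
    same*₋ : ∀ {j} → j ≢ i → lam* (v₋ j) ≈ ρ* (v₋ j)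
    same*₋ j≢i = same* (v₋ _) (λ ()) (λ { ≡.refl → j≢i ≡.refl })

    symλ : IsSymLabel lam
    symλ a = ≈-trans (same (v₊ a) (λ ())) (≈-trans (symρ a) (≈-sym (same (v₋ a) (λ ()))))

    symλ* : IsSymLabel lam*
    symλ* j with j ≟ᶠ i
    ... | yes ≡.refl = ≈-sym λ*₋≈λ*₊
    ... | no j≢i = ≈-trans (same*₊ j≢i) (≈-trans (symρ* j) (≈-sym (same*₋ j≢i)))

    dual-centre₊ : ∀ a → lam* (v₀ a) ≈ s * lam (v₊ a)
    dual-centre₊ a = ≈-trans (same* (v₀ a) (λ ()) (λ ()))
                             (≈-trans (ρ*≈sρ₊ a) (*-cong ≈-refl (≈-sym (same (v₊ a) (λ ())))))

    dual-centre₋ : ∀ a → lam* (v₀ a) ≈ s * lam (v₋ a)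
    dual-centre₋ a = ≈-trans (same* (v₀ a) (λ ()) (λ ()))
                             (≈-trans (ρ*≈sρ₋ a) (*-cong ≈-refl (≈-sym (same (v₋ a) (λ ())))))

    dual-pair₊ : ∀ j → s * lam* (v₊ j) ≈ lam (v₀ j)
    dual-pair₊ j with j ≟ᶠ i
    ... | yes ≡.refl = sλ*₊≈λ
    ... | no j≢i = ≈-trans (*-cong ≈-refl (same*₊ j≢i)) (≈-trans (sρ*₊≈ρ j) (≈-sym (same₀ j≢i)))

    dual-pair₋ : ∀ j → s * lam* (v₋ j) ≈ lam (v₀ j)
    dual-pair₋ j with j ≟ᶠ i
    ... | yes ≡.refl = ≈-trans (*-cong ≈-refl λ*₋≈λ*₊) sλ*₊≈λ
    ... | no j≢i = ≈-trans (*-cong ≈-refl (same*₋ j≢i)) (≈-trans (sρ*₋≈ρ j) (≈-sym (same₀ j≢i)))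

  -- the new labels at u_i^- and u_i^+ agree, since both neighbour sums and
  -- the old labels agree there
  new-label-pair : ∀ {k m} (B* : SUB m k) {ρ* lam* : Vtx m k → Carrier} → IsSymLabel ρ* → (i : Fin m) →
    IsMax (nbrSum (SUB.Γ B*) ρ* (v₋ i)) (nbrSum (SUB.Δ B*) ρ* (v₋ i)) (lam* (v₋ i) + ρ* (v₋ i)) →
    IsMax (nbrSum (SUB.Γ B*) ρ* (v₊ i)) (nbrSum (SUB.Δ B*) ρ* (v₊ i)) (lam* (v₊ i) + ρ* (v₊ i)) →
    lam* (v₋ i) ≈ lam* (v₊ i)
  new-label-pair B* {ρ*} {lam*} symρ* i max₋ max₊ =
    +-cancelʳ (ρ* (v₊ i)) (lam* (v₋ i)) (lam* (v₊ i)) (begin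
      lam* (v₋ i) + ρ* (v₊ i) ≈⟨ +-cong ≈-refl (symρ* i) ⟩
      lam* (v₋ i) + ρ* (v₋ i) ≈⟨ IsMax-unique max₋ max₊ (nbrSum-inv (SUB.Γ B*) ρ* (SUB.inv-Γ B*) symρ* (v₊ i))
                                                      (nbrSum-inv (SUB.Δ B*) ρ* (SUB.inv-Δ B*) symρ* (v₊ i)) ⟩
      lam* (v₊ i) + ρ* (v₊ i) ∎)

  -- the new label at u_i^+ is s⁻¹ times the new label at v_i, since the
  -- neighbour sums and old labels there correspond under scaling by s
  new-label-centre : ∀ {k m} {s} (B : SUB k m) (B* : SUB m k) {ρ lam : Vtx k m → Carrier} {ρ* lam* : Vtx m k → Carrier} →
    0# ≤ s → s * s ≈ 2# → IsSymLabel ρ → IsDualU B B* → DualLabels s ρ ρ* → (i : Fin m) →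
    IsMax (nbrSum (SUB.Γ B) ρ (v₀ i)) (nbrSum (SUB.Δ B) ρ (v₀ i)) (lam (v₀ i) + ρ (v₀ i)) →
    IsMax (nbrSum (SUB.Γ B*) ρ* (v₊ i)) (nbrSum (SUB.Δ B*) ρ* (v₊ i)) (lam* (v₊ i) + ρ* (v₊ i)) →
    s * lam* (v₊ i) ≈ lam (v₀ i)
  new-label-centre {s = s} B B* {ρ} {lam} {ρ*} {lam*} 0≤s s²≈2 symρ (_ , _ , _ , dualΓ , dualΔ)
                   dualL@(_ , _ , sρ*₊≈ρ , _) i maxV max₊ =
    +-cancelʳ (ρ (v₀ i)) (s * lam* (v₊ i)) (lam (v₀ i)) (begin
      s * lam* (v₊ i) + ρ (v₀ i)       ≈⟨ +-cong ≈-refl (sρ*₊≈ρ i) ⟨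
      s * lam* (v₊ i) + s * ρ* (v₊ i)  ≈⟨ distribˡ s (lam* (v₊ i)) (ρ* (v₊ i)) ⟨
      s * (lam* (v₊ i) + ρ* (v₊ i))    ≈⟨ IsMax-unique (IsMax-scale 0≤s max₊) maxV scaledΓ scaledΔ ⟩
      lam (v₀ i) + ρ (v₀ i)            ∎)
    where
    scaledΓ : s * nbrSum (SUB.Γ B*) ρ* (v₊ i) ≈ nbrSum (SUB.Γ B) ρ (v₀ i)
    scaledΓ = DualNeighbours.scaled-nbrSum (SUB.Γ B) (SUB.X B) (SUB.Γ B*) (SUB.X B*)
                (SUB.inv-Γ B) (SUB.inv-Γ B*) (SUB.Γ-sym B*) dualΓ i {s} {ρ} {ρ*} s²≈2 symρ dualL
    scaledΔ : s * nbrSum (SUB.Δ B*) ρ* (v₊ i) ≈ nbrSum (SUB.Δ B) ρ (v₀ i)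
    scaledΔ = DualNeighbours.scaled-nbrSum (SUB.Δ B) (SUB.X B) (SUB.Δ B*) (SUB.X B*)
                (SUB.inv-Δ B) (SUB.inv-Δ B*) (SUB.Δ-sym B*) dualΔ i {s} {ρ} {ρ*} s²≈2 symρ dualL

open Lemmas using (relabel-dual; new-label-pair; new-label-centre)
open WithReals
open RealField

proposition9p3 :
    (R : RealField) (s : Carrier R) → _<_ R (0# R) s → _≈_ R (_*_ R s s) (2# R) →
    {k m : ℕ} (B : SUB k m) (B* : SUB m k)
    (ρ : Vtx k m → Carrier R) (ρ* : Vtx m k → Carrier R) →
    IsSymLabel R ρ → IsSymLabel R ρ* →
    IsDual R s B ρ B* ρ* →
    (i : Fin m)
    (lam : Vtx k m → Carrier R) (lam* : Vtx m k → Carrier R) →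
    (∀ v → v ≢ v₀ i → _≈_ R (lam v) (ρ v)) →
    IsMax R (nbrSum R (SUB.Γ B) ρ (v₀ i)) (nbrSum R (SUB.Δ B) ρ (v₀ i))
            (_+_ R (lam (v₀ i)) (ρ (v₀ i))) →
    (∀ u → u ≢ v₊ i → u ≢ v₋ i → _≈_ R (lam* u) (ρ* u)) →
    IsMax R (nbrSum R (SUB.Γ B*) ρ* (v₊ i)) (nbrSum R (SUB.Δ B*) ρ* (v₊ i))
            (_+_ R (lam* (v₊ i)) (ρ* (v₊ i))) →
    IsMax R (nbrSum R (SUB.Γ B*) ρ* (v₋ i)) (nbrSum R (SUB.Δ B*) ρ* (v₋ i))
            (_+_ R (lam* (v₋ i)) (ρ* (v₋ i))) →
    IsSymLabel R lam × IsSymLabel R lam* × IsDual R s B lam B* lam*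
proposition9p3 R s 0<s s²≈2 B B* ρ ρ* symρ symρ* (dualU , dualL) i lam lam* same maxV same* max₊ max₋
  with relabel-dual R {ρ = ρ} {lam} {ρ*} {lam*} i symρ symρ* dualL same same*
         (new-label-pair R B* {ρ*} {lam*} symρ* i max₋ max₊)
         (new-label-centre R B B* {ρ} {lam} {ρ*} {lam*} (proj₁ 0<s) s²≈2 symρ dualU dualL i maxV max₊)
... | symλ , symλ* , dualλ = symλ , symλ* , dualU , dualλ
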